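{- The $\mathbb{Z}$-modules $\mathcal{M}_{2,1}^-(C_N\times C_{MN})$ and $\mathbb{M}_2(\Gamma(N, MN))$ are isomorphic when $N\in\mathbb{Z}_{>2}$ and $M\in\mathbb{Z}_{\geq1}$.
   Context: Let $N\geq 2$, $M\geq1$ be integers, $C_k$ the cyclic group of order $k$, and identify $(C_N\times C_{MN})^\vee$ with $\mathbb{Z}/N\times\mathbb{Z}/MN$. For $k\in(\mathbb{Z}/N)^\times$, let $\mathcal{S}_{2,k}(C_N\times C_{MN})$ be the finite set of symbols $\langle(a_1,b_1),(a_2,b_2)\rangle^-$, written as matrices $\begin{pmatrix} a_1&a_2\\ b_1&b_2\end{pmatrix}$, with $a_i\in\mathbb{Z}/N$, $b_i\in\mathbb{Z}/MN$, $\mathbb{Z}(a_1,b_1)+\mathbb{Z}(a_2,b_2)=(C_N\times C_{MN})^\vee$ and $a_1b_2-a_2b_1\equiv k\pmod N$. The module $\mathcal{M}_{2,1}^-(C_N\times C_{MN})$ is the $\mathbb{Z}$-module freely generated by $\mathcal{S}_{2,1}\cup\mathcal{S}_{2,-1}$ modulo the relations: (O) $\langle \beta_1,\beta_2\rangle^-=\langle\beta_2,\beta_1\rangle^-$; (M) $\langle \beta_1,\beta_2\rangle^-=\langle \beta_1-\beta_2,\beta_2\rangle^-+\langle \beta_1,\beta_2-\beta_1\rangle^-$; (A) $\langle \beta_1,\beta_2\rangle^-=-\langle -\beta_1,\beta_2\rangle^-$. The congruence subgroup $\Gamma(N,MN)$ consists of $\begin{pmatrix}a&b\\c&d\end{pmatrix}\in\mathrm{SL}_2(\mathbb{Z})$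 with $a\equiv1,\ b\equiv0 \pmod N$ and $c\equiv 0,\ d\equiv 1\pmod{MN}$; its right cosets $\Gamma(N,MN)\backslash\mathrm{SL}_2(\mathbb{Z})$ are in bijection with $\mathcal{S}_{2,1}(C_N\times C_{MN})$ via reduction of entries ($a,b$ mod $N$, $c,d$ mod $MN$). The space $\mathbb{M}_2(\Gamma(N,MN))$ of (Manin) modular symbols of weight 2 is the $\mathbb{Z}$-module generated by $\begin{pmatrix} a&b\\c&d\end{pmatrix}\in\mathcal{S}_{2,1}(C_N\times C_{MN})$ subject to (1) $\begin{pmatrix} a&b\\c&d\end{pmatrix}+\begin{pmatrix} b&-a\\d&-c\end{pmatrix}=0$; (2) $\begin{pmatrix} a&b\\c&d\end{pmatrix}+\begin{pmatrix} a+b&-a\\c+d&-c\end{pmatrix}+\begin{pmatrix} b&-a-b\\d&-c-d\end{pmatrix}=0$; (3) $\begin{pmatrix} a&b\\c&d\end{pmatrix}=0$ if it equals $\begin{pmatrix} b&-a\\d&-c\end{pmatrix}$ or $\begin{pmatrix} a+b&-a\\c+d&-c\end{pmatrix}$. -}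

module Defs where

open import Level using (0ℓ)
open import Data.Nat using (ℕ) renaming (_*_ to _*ℕ_)
open import Data.Integer using (ℤ; +_; -_; _-_; 1ℤ) renaming (_+_ to _+ℤ_; _*_ to _*ℤ_)
open import Data.Integer.Divisibility using (_∣_)
open import Data.Product using (Σ; ∃₂; _×_; _,_; proj₁)
open import Data.Sum using (_⊎_)
open import Relation.Binary.Core using (Rel)
open import Algebra.Bundles using (AbelianGroup)
open import Algebra.Structures using (IsAbelianGroup)
import Algebra.Morphism.Structures as MS

-- Finitely presented abelian groups (= ℤ-modules), as setoids.

infixl 6 _⊕_
data Term (G : Set) : Set where
  gen  : G → Term G
  𝟎    : Term G
  _⊕_  : Term G → Term G → Term G
  ⊖_   : Term G → Term G

data Eqv {G : Set} (R : Rel (Term G) 0ℓ) : Term G → Term G → Set where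
  rel    : ∀ {x y} → R x y → Eqv R x y
  refl   : ∀ {x} → Eqv R x x
  sym    : ∀ {x y} → Eqv R x y → Eqv R y x
  trans  : ∀ {x y z} → Eqv R x y → Eqv R y z → Eqv R x z
  ⊕-cong : ∀ {x x' y y'} → Eqv R x x' → Eqv R y y' → Eqv R (x ⊕ y) (x' ⊕ y')
  ⊖-cong : ∀ {x x'} → Eqv R x x' → Eqv R (⊖ x) (⊖ x')
  assoc  : ∀ {x y z} → Eqv R ((x ⊕ y) ⊕ z) (x ⊕ (y ⊕ z))
  comm   : ∀ {x y} → Eqv R (x ⊕ y) (y ⊕ x)
  idˡ    : ∀ {x} → Eqv R (𝟎 ⊕ x) x
  invˡ   : ∀ {x} → Eqv R ((⊖ x) ⊕ x) 𝟎

Presented : (G : Set) → Rel (Term G) 0ℓ → AbelianGroup 0ℓ 0ℓ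
Presented G R = record
  { Carrier = Term G ; _≈_ = λ x y → Eqv R x y
  ; _∙_ = _⊕_ ; ε = 𝟎 ; _⁻¹ = ⊖_
  ; isAbelianGroup = record
    { isGroup = record
      { isMonoid = record
        { isSemigroup = record
          { isMagma = record
            { isEquivalence = record { refl = refl ; sym = sym ; trans = trans }
            ; ∙-cong = ⊕-cong }
          ; assoc = λ _ _ _ → assoc }
        ; identity = (λ _ → idˡ) , (λ _ → trans comm idˡ) }
      ; inverse = (λ _ → invˡ) , (λ _ → trans comm invˡ)
      ; ⁻¹-cong = ⊖-cong }
    ; comm = λ _ _ → comm } }

_≅_ : AbelianGroup 0ℓ 0ℓ → AbelianGroup 0ℓ 0ℓ → Set
A ≅ B = Σ (AbelianGroup.Carrier A → AbelianGroup.Carrier B)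
          (MS.GroupMorphisms.IsGroupIsomorphism (AbelianGroup.rawGroup A) (AbelianGroup.rawGroup B))

-- Characters of C_N × C_{MN}: (C_N × C_{MN})^∨ ≅ ℤ/N × ℤ/MN,
-- represented by integer pairs up to congruence.

_≡_[mod_] : ℤ → ℤ → ℕ → Set
x ≡ y [mod n ] = (+ n) ∣ (x - y)

Char : Set
Char = ℤ × ℤ

module _ (N M : ℕ) where

  _∼_ : Char → Char → Set
  (x , y) ∼ (x' , y') = (x ≡ x' [mod N ]) × (y ≡ y' [mod (M *ℕ N) ])

  -- a symbol ⟨β₁,β₂⟩ (= matrix with columns β₁, β₂), up to congruence
  _≃_ : Char × Char → Char × Char → Set
  (β₁ , β₂) ≃ (γ₁ , γ₂) = (β₁ ∼ γ₁) × (β₂ ∼ γ₂)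

  Generates : Char × Char → Set
  Generates ((x₁ , y₁) , (x₂ , y₂)) =
    ∀ (γ : Char) → ∃₂ λ m n → ((m *ℤ x₁ +ℤ n *ℤ x₂) , (m *ℤ y₁ +ℤ n *ℤ y₂)) ∼ γ

  InS : ℤ → Char × Char → Set
  InS k s@((x₁ , y₁) , (x₂ , y₂)) = Generates s × ((x₁ *ℤ y₂ - x₂ *ℤ y₁) ≡ k [mod N ])

infixl 6 _-ᶜ_ _+ᶜ_
_-ᶜ_ _+ᶜ_ : Char → Char → Char
(x , y) -ᶜ (x' , y') = (x - x' , y - y')
(x , y) +ᶜ (x' , y') = (x +ℤ x' , y +ℤ y')

-ᶜ_ : Char → Char
-ᶜ (x , y) = (- x , - y)

module _ (N M : ℕ) where

  GenM : Set
  GenM = Σ (Char × Char) λ s → InS N M 1ℤ s ⊎ InS N M (- 1ℤ) s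

  data RelM : Rel (Term GenM) 0ℓ where
    -- a symbol depends only on its residues
    ident : ∀ {s t} (p : _) (q : _) → _≃_ N M s t → RelM (gen (s , p)) (gen (t , q))
    relO  : ∀ {β₁ β₂} (p : _) (q : _) → RelM (gen ((β₁ , β₂) , p)) (gen ((β₂ , β₁) , q))
    relM  : ∀ {β₁ β₂} (p : _) (q : _) (r : _) →
            RelM (gen ((β₁ , β₂) , p))
                 (gen ((β₁ -ᶜ β₂ , β₂) , q) ⊕ gen ((β₁ , β₂ -ᶜ β₁) , r))
    relA  : ∀ {β₁ β₂} (p : _) (q : _) →
            RelM (gen ((β₁ , β₂) , p)) (⊖ gen ((-ᶜ β₁ , β₂) , q))

  𝓜⁻ : AbelianGroup 0ℓ 0ℓ
  𝓜⁻ = Presented GenM RelM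

mat : ℤ → ℤ → ℤ → ℤ → Char × Char
mat a b c d = ((a , c) , (b , d))

module _ (N M : ℕ) where

  GenΓ : Set
  GenΓ = Σ (Char × Char) (InS N M 1ℤ)

  data RelΓ : Rel (Term GenΓ) 0ℓ where
    ident : ∀ {s t} (p : _) (q : _) → _≃_ N M s t → RelΓ (gen (s , p)) (gen (t , q))
    rel1  : ∀ {a b c d} (p : _) (q : _) →
            RelΓ (gen (mat a b c d , p) ⊕ gen (mat b (- a) d (- c) , q)) 𝟎
    rel2  : ∀ {a b c d} (p : _) (q : _) (r : _) →
            RelΓ (gen (mat a b c d , p) ⊕ gen (mat (a +ℤ b) (- a) (c +ℤ d) (- c) , q)
                    ⊕ gen (mat b (- a - b) d (- c - d) , r)) 𝟎
    rel3a : ∀ {a b c d} (p : _) →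
            _≃_ N M (mat a b c d) (mat b (- a) d (- c)) → RelΓ (gen (mat a b c d , p)) 𝟎
    rel3b : ∀ {a b c d} (p : _) →
            _≃_ N M (mat a b c d) (mat (a +ℤ b) (- a) (c +ℤ d) (- c)) → RelΓ (gen (mat a b c d , p)) 𝟎

  𝕄₂Γ : AbelianGroup 0ℓ 0ℓ
  𝕄₂Γ = Presented GenΓ RelΓ

{-# OPTIONS --safe #-}
module Submission where

open import Defs
open import Level using (0ℓ)
open import Data.Nat using (ℕ; _<_; _≤_) renaming (_*_ to _*ℕ_)
open import Data.Nat.Properties using (<⇒≤)
import Data.Nat.Divisibility as ℕ
open import Data.Integer using (ℤ; +_; -_; _-_; 1ℤ; 0ℤ; _+_; _*_)
open import Data.Integer.Properties using (neg-involutive; neg-distrib-+; +-inverseʳ; +-comm; +-minus-telescope)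
open import Data.Integer.Divisibility.Signed
  using (divides; ∣ᵤ⇒∣; ∣⇒∣ᵤ; ∣m⇒∣-m; ∣m∣n⇒∣m+n; ∣m∣n⇒∣m-n; ∣m⇒∣m*n; ∣n⇒∣m*n) renaming (_∣_ to _∣ˢ_)
open import Data.Integer.Tactic.RingSolver using (solve-∀)
open import Data.Product using (_×_; _,_; ∃₂; swap)
open import Data.Sum using (_⊎_; inj₁; inj₂)
open import Data.Empty using (⊥; ⊥-elim)
open import Relation.Nullary using (¬_)
open import Relation.Unary using (_⊆_)
open import Relation.Binary.Core using (Rel)
open import Relation.Binary.PropositionalEquality using (_≡_; refl; cong; cong₂; subst)
  renaming (sym to ≡-sym)
import Relation.Binary.Reasoning.Setoid as SetoidReasoning
open import Algebra.Bundles using (AbelianGroup)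
import Algebra.Properties.Group as GroupProperties

-- Since N > 2, symbols of determinant 1 and of determinant −1 mod N never coincide. The
-- isomorphism sends a symbol ⟨s⟩ of determinant 1 to the Manin symbol [s], and one of
-- determinant −1 to [swap s], as (O) dictates; the inverse sends [s] to ⟨s⟩. Under these maps
-- (O) holds by construction, (A) becomes relation (1), i.e. [β₁,β₂] = −[β₂,−β₁], and (M) follows
-- from the three-term relation (2) at (β₁ − β₂, β₂) together with (1). Conversely (1) is (O)
-- followed by (A), (2) is (M) at (β₁ + β₂, β₂) together with (1), and (3) is vacuous: a symbol
-- congruent to its image under S or ST has determinant 0 mod N.

extend : ∀ {G H : Set} → (G → Term H) → Term G → Term H
extend φ (gen g) = φ g
extend φ 𝟎       = 𝟎
extend φ (x ⊕ y) = extend φ x ⊕ extend φ y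
extend φ (⊖ x)   = ⊖ extend φ x

module _ {G H : Set} {R : Rel (Term G) 0ℓ} where

  extend-cong : ∀ {S : Rel (Term H) 0ℓ} (φ : G → Term H) →
                (∀ {x y} → R x y → Eqv S (extend φ x) (extend φ y)) →
                ∀ {x y} → Eqv R x y → Eqv S (extend φ x) (extend φ y)
  extend-cong φ resp (rel r)       = resp r
  extend-cong φ resp refl          = refl
  extend-cong φ resp (sym e)       = sym (extend-cong φ resp e)
  extend-cong φ resp (trans e e')  = trans (extend-cong φ resp e) (extend-cong φ resp e')
  extend-cong φ resp (⊕-cong e e') = ⊕-cong (extend-cong φ resp e) (extend-cong φ resp e')
  extend-cong φ resp (⊖-cong e)    = ⊖-cong (extend-cong φ resp e)
  extend-cong φ resp assoc         = assoc
  extend-cong φ resp comm          = comm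
  extend-cong φ resp idˡ           = idˡ
  extend-cong φ resp invˡ          = invˡ

  extend-retraction : (φ : G → Term H) (ψ : H → Term G) →
                      (∀ g → Eqv R (extend ψ (φ g)) (gen g)) →
                      ∀ x → Eqv R (extend ψ (extend φ x)) x
  extend-retraction φ ψ inv (gen g) = inv g
  extend-retraction φ ψ inv 𝟎       = refl
  extend-retraction φ ψ inv (x ⊕ y) =
    ⊕-cong (extend-retraction φ ψ inv x) (extend-retraction φ ψ inv y)
  extend-retraction φ ψ inv (⊖ x)   = ⊖-cong (extend-retraction φ ψ inv x)

Presented-≅ : ∀ {G H : Set} {R : Rel (Term G) 0ℓ} {S : Rel (Term H) 0ℓ}
              (φ : G → Term H) (ψ : H → Term G) →
              (∀ {x y} → R x y → Eqv S (extend φ x) (extend φ y)) →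
              (∀ {x y} → S x y → Eqv R (extend ψ x) (extend ψ y)) →
              (∀ g → Eqv R (extend ψ (φ g)) (gen g)) →
              (∀ h → Eqv S (extend φ (ψ h)) (gen h)) →
              Presented G R ≅ Presented H S
Presented-≅ φ ψ φ-resp ψ-resp ψφ φψ = extend φ , record
  { isGroupMonomorphism = record
    { isGroupHomomorphism = record
      { isMonoidHomomorphism = record
        { isMagmaHomomorphism = record
          { isRelHomomorphism = record { cong = extend-cong φ φ-resp }
          ; homo = λ _ _ → refl }
        ; ε-homo = refl }
      ; ⁻¹-homo = λ _ → refl }
    ; injective = λ {x} {y} e → trans (sym (extend-retraction φ ψ ψφ x))
                                      (trans (extend-cong ψ ψ-resp e) (extend-retraction φ ψ ψφ y)) }
  ; surjective = λ y → extend ψ y , λ e → trans (extend-cong φ φ-resp e) (extend-retraction ψ φ φψ y) }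

-- The integers are explicit arguments: x ≡ y [mod n ] unfolds to n ∣ ∣ x - y ∣, from which
-- Agda cannot recover x and y (nor k from InS N M k s below).
module _ {n : ℕ} where

  private
    divides-diff : ∀ x y → x ≡ y [mod n ] → (+ n) ∣ˢ (x - y)
    divides-diff x y = ∣ᵤ⇒∣ {+ n} {x - y}

    ≡-mod-via : ∀ x y {d} → x - y ≡ d → (+ n) ∣ˢ d → x ≡ y [mod n ]
    ≡-mod-via x y eq n∣d = ∣⇒∣ᵤ {+ n} {x - y} (subst ((+ n) ∣ˢ_) (≡-sym eq) n∣d)

  ≡-mod-refl : ∀ x → x ≡ x [mod n ]
  ≡-mod-refl x = ≡-mod-via x x (+-inverseʳ x) (divides 0ℤ refl)

  ≡-mod-sym : ∀ x y → x ≡ y [mod n ] → y ≡ x [mod n ]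
  ≡-mod-sym x y x≡y = ≡-mod-via y x (flip x y) (∣m⇒∣-m (divides-diff x y x≡y))
    where flip : ∀ x y → y - x ≡ - (x - y)
          flip = solve-∀

  ≡-mod-trans : ∀ x y z → x ≡ y [mod n ] → y ≡ z [mod n ] → x ≡ z [mod n ]
  ≡-mod-trans x y z x≡y y≡z = ≡-mod-via x z (≡-sym (+-minus-telescope x y z))
    (∣m∣n⇒∣m+n (divides-diff x y x≡y) (divides-diff y z y≡z))

  -‿cong-mod : ∀ x y → x ≡ y [mod n ] → (- x) ≡ (- y) [mod n ]
  -‿cong-mod x y x≡y =
    ≡-mod-via (- x) (- y) (≡-sym (neg-distrib-+ x (- y))) (∣m⇒∣-m (divides-diff x y x≡y))

  *-cong-mod : ∀ x x′ y y′ → x ≡ x′ [mod n ] → y ≡ y′ [mod n ] → (x * y) ≡ (x′ * y′) [mod n ]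
  *-cong-mod x x′ y y′ x≡x′ y≡y′ = ≡-mod-via (x * y) (x′ * y′) (split x x′ y y′)
    (∣m∣n⇒∣m+n (∣m⇒∣m*n y (divides-diff x x′ x≡x′)) (∣n⇒∣m*n x′ (divides-diff y y′ y≡y′)))
    where split : ∀ x x′ y y′ → x * y - x′ * y′ ≡ (x - x′) * y + x′ * (y - y′)
          split = solve-∀

  minus-cong-mod : ∀ x x′ y y′ → x ≡ x′ [mod n ] → y ≡ y′ [mod n ] → (x - y) ≡ (x′ - y′) [mod n ]
  minus-cong-mod x x′ y y′ x≡x′ y≡y′ = ≡-mod-via (x - y) (x′ - y′) (split x x′ y y′)
    (∣m∣n⇒∣m-n (divides-diff x x′ x≡x′) (divides-diff y y′ y≡y′))
    where split : ∀ x x′ y y′ → (x - y) - (x′ - y′) ≡ (x - x′) - (y - y′)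
          split = solve-∀

1≢-1-mod : ∀ {n} → 2 < n → ¬ (1ℤ ≡ - 1ℤ [mod n ])
1≢-1-mod = ℕ.>⇒∤

1≢0-mod : ∀ {n} → 1 < n → ¬ (1ℤ ≡ 0ℤ [mod n ])
1≢0-mod = ℕ.>⇒∤

-ᶜ-involutive : ∀ β → -ᶜ -ᶜ β ≡ β
-ᶜ-involutive (x , y) = cong₂ _,_ (neg-involutive x) (neg-involutive y)

-ᶜ-distrib-+ᶜ : ∀ β γ → -ᶜ (β +ᶜ γ) ≡ -ᶜ β -ᶜ γ
-ᶜ-distrib-+ᶜ (x , y) (x′ , y′) = cong₂ _,_ (neg-distrib-+ x x′) (neg-distrib-+ y y′)

x-y+y≡x : ∀ β γ → (β -ᶜ γ) +ᶜ γ ≡ β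
x-y+y≡x (x , y) (x′ , y′) = cong₂ _,_ (ι x x′) (ι y y′)
  where ι : ∀ a b → (a - b) + b ≡ a
        ι = solve-∀

x+y-y≡x : ∀ β γ → (β +ᶜ γ) -ᶜ γ ≡ β
x+y-y≡x (x , y) (x′ , y′) = cong₂ _,_ (ι x x′) (ι y y′)
  where ι : ∀ a b → (a + b) - b ≡ a
        ι = solve-∀

-[x-y]≡y-x : ∀ β γ → -ᶜ (β -ᶜ γ) ≡ γ -ᶜ β
-[x-y]≡y-x (x , y) (x′ , y′) = cong₂ _,_ (ι x x′) (ι y y′)
  where ι : ∀ a b → - (a - b) ≡ b - a
        ι = solve-∀

-[x-y]-y≡-x : ∀ β γ → -ᶜ (β -ᶜ γ) -ᶜ γ ≡ -ᶜ β
-[x-y]-y≡-x (x , y) (x′ , y′) = cong₂ _,_ (ι x x′) (ι y y′)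
  where ι : ∀ a b → - (a - b) - b ≡ - a
        ι = solve-∀

y-[x+y]≡-x : ∀ β γ → γ -ᶜ (β +ᶜ γ) ≡ -ᶜ β
y-[x+y]≡-x (x , y) (x′ , y′) = cong₂ _,_ (ι x x′) (ι y y′)
  where ι : ∀ a b → b - (a + b) ≡ - a
        ι = solve-∀

-[-x-y]≡x+y : ∀ β γ → -ᶜ (-ᶜ β -ᶜ γ) ≡ β +ᶜ γ
-[-x-y]≡x+y (x , y) (x′ , y′) = cong₂ _,_ (ι x x′) (ι y y′)
  where ι : ∀ a b → - (- a - b) ≡ a + b
        ι = solve-∀

det : Char × Char → ℤ
det ((x₁ , y₁) , (x₂ , y₂)) = x₁ * y₂ - x₂ * y₁

lincomb : ℤ → ℤ → Char × Char → Char
lincomb m n ((x₁ , y₁) , (x₂ , y₂)) = (m * x₁ + n * x₂ , m * y₁ + n * y₂)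

Span : Char × Char → Char → Set
Span s β = ∃₂ λ m n → lincomb m n s ≡ β

negateˡ : Char × Char → Char × Char
negateˡ (β₁ , β₂) = (-ᶜ β₁ , β₂)

shearˡ : Char × Char → Char × Char
shearˡ (β₁ , β₂) = (β₁ -ᶜ β₂ , β₂)

shearʳ : Char × Char → Char × Char
shearʳ (β₁ , β₂) = (β₁ , β₂ -ᶜ β₁)

rotate : Char × Char → Char × Char
rotate (β₁ , β₂) = (β₂ , -ᶜ β₁)

swap-span : ∀ {s} → Span s ⊆ Span (swap s)
swap-span {(x₁ , y₁) , (x₂ , y₂)} (m , n , refl) =
  n , m , cong₂ _,_ (+-comm (n * x₂) (m * x₁)) (+-comm (n * y₂) (m * y₁))

negateˡ-span : ∀ {s} → Span s ⊆ Span (negateˡ s)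
negateˡ-span {(x₁ , y₁) , (x₂ , y₂)} (m , n , refl) =
  - m , n , cong₂ _,_ (ι m n x₁ x₂) (ι m n y₁ y₂)
  where ι : ∀ m n a b → (- m) * (- a) + n * b ≡ m * a + n * b
        ι = solve-∀

shearˡ-span : ∀ {s} → Span s ⊆ Span (shearˡ s)
shearˡ-span {(x₁ , y₁) , (x₂ , y₂)} (m , n , refl) =
  m , m + n , cong₂ _,_ (ι m n x₁ x₂) (ι m n y₁ y₂)
  where ι : ∀ m n a b → m * (a - b) + (m + n) * b ≡ m * a + n * b
        ι = solve-∀

det-swap : ∀ s → det (swap s) ≡ - det s
det-swap ((x₁ , y₁) , (x₂ , y₂)) = ι x₁ y₁ x₂ y₂
  where ι : ∀ x₁ y₁ x₂ y₂ → x₂ * y₁ - x₁ * y₂ ≡ - (x₁ * y₂ - x₂ * y₁)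
        ι = solve-∀

det-negateˡ : ∀ s → det (negateˡ s) ≡ - det s
det-negateˡ ((x₁ , y₁) , (x₂ , y₂)) = ι x₁ y₁ x₂ y₂
  where ι : ∀ x₁ y₁ x₂ y₂ → (- x₁) * y₂ - x₂ * (- y₁) ≡ - (x₁ * y₂ - x₂ * y₁)
        ι = solve-∀

det-shearˡ : ∀ s → det (shearˡ s) ≡ det s
det-shearˡ ((x₁ , y₁) , (x₂ , y₂)) = ι x₁ y₁ x₂ y₂
  where ι : ∀ x₁ y₁ x₂ y₂ → (x₁ - x₂) * y₂ - x₂ * (y₁ - y₂) ≡ x₁ * y₂ - x₂ * y₁
        ι = solve-∀

det-diagonal : ∀ β → det (β , β) ≡ 0ℤ
det-diagonal (x , y) = +-inverseʳ (x * y)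

det-antidiagonal : ∀ β → det (β , -ᶜ β) ≡ 0ℤ
det-antidiagonal (x , y) = ι x y
  where ι : ∀ x y → x * (- y) - (- x) * y ≡ 0ℤ
        ι = solve-∀

module Symbols (N M : ℕ) where

  Generates-mono : ∀ {s t} → Span s ⊆ Span t → Generates N M s → Generates N M t
  Generates-mono {s} {t} s⊆t generates γ with generates γ
  ... | m , n , m,n↦γ with s⊆t (m , n , refl)
  ...   | m′ , n′ , eq = m′ , n′ , subst (λ β → _∼_ N M β γ) (≡-sym eq) m,n↦γ

  InS-swap : ∀ k {s} → InS N M k s → InS N M (- k) (swap s)
  InS-swap k {s} (generates , det≡k) =
    Generates-mono swap-span generates ,
    subst (λ d → d ≡ (- k) [mod N ]) (≡-sym (det-swap s)) (-‿cong-mod (det s) k det≡k)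

  InS-negateˡ : ∀ k {s} → InS N M k s → InS N M (- k) (negateˡ s)
  InS-negateˡ k {s} (generates , det≡k) =
    Generates-mono negateˡ-span generates ,
    subst (λ d → d ≡ (- k) [mod N ]) (≡-sym (det-negateˡ s)) (-‿cong-mod (det s) k det≡k)

  InS-shearˡ : ∀ k {s} → InS N M k s → InS N M k (shearˡ s)
  InS-shearˡ k {s} (generates , det≡k) =
    Generates-mono shearˡ-span generates ,
    subst (λ d → d ≡ k [mod N ]) (≡-sym (det-shearˡ s)) det≡k

  InS-shearʳ : ∀ k {s} → InS N M k s → InS N M k (shearʳ s)
  InS-shearʳ k p =
    subst (λ k → InS N M k _) (neg-involutive k) (InS-swap (- k) (InS-shearˡ (- k) (InS-swap k p)))

  InS-rotate : ∀ k {s} → InS N M k s → InS N M k (rotate s)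
  InS-rotate k p = subst (λ k → InS N M k _) (neg-involutive k) (InS-swap (- k) (InS-negateˡ k p))

  ∼-refl : ∀ β → _∼_ N M β β
  ∼-refl (x , y) = ≡-mod-refl x , ≡-mod-refl y

  ≃-refl : ∀ s → _≃_ N M s s
  ≃-refl (β₁ , β₂) = ∼-refl β₁ , ∼-refl β₂

  det-cong : ∀ {s t} → _≃_ N M s t → det s ≡ det t [mod N ]
  det-cong {(x₁ , y₁) , (x₂ , y₂)} {(x₁′ , y₁′) , (x₂′ , y₂′)} ((x₁≡ , y₁≡) , (x₂≡ , y₂≡)) =
    minus-cong-mod (x₁ * y₂) (x₁′ * y₂′) (x₂ * y₁) (x₂′ * y₁′)
      (*-cong-mod x₁ x₁′ y₂ y₂′ x₁≡ (mod-N y₂ y₂′ y₂≡))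
      (*-cong-mod x₂ x₂′ y₁ y₁′ x₂≡ (mod-N y₁ y₁′ y₁≡))
    where mod-N : ∀ x y → x ≡ y [mod M *ℕ N ] → x ≡ y [mod N ]
          mod-N _ _ = ℕ.∣-trans (ℕ.n∣m*n M)

  𝒮₊ 𝒮₋ 𝒮± : Char × Char → Set
  𝒮₊ = InS N M 1ℤ
  𝒮₋ = InS N M (- 1ℤ)
  𝒮± s = 𝒮₊ s ⊎ 𝒮₋ s

  𝒮₊-𝒮₋-disjoint : 2 < N → ∀ {s t} → 𝒮₊ s → 𝒮₋ t → det s ≡ det t [mod N ] → ⊥
  𝒮₊-𝒮₋-disjoint 2<N {s} {t} (_ , det≡1) (_ , det≡-1) det≡det = 1≢-1-mod 2<N
    (≡-mod-trans 1ℤ (det s) (- 1ℤ) (≡-mod-sym (det s) 1ℤ det≡1)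
      (≡-mod-trans (det s) (det t) (- 1ℤ) det≡det det≡-1))

  𝒮₊-nondegenerate : 1 < N → ∀ {s t} → 𝒮₊ s → _≃_ N M s t → det t ≡ 0ℤ → ⊥
  𝒮₊-nondegenerate 1<N {s} {t} (_ , det≡1) s≃t det≡0 = 1≢0-mod 1<N
    (≡-mod-trans 1ℤ (det s) 0ℤ (≡-mod-sym (det s) 1ℤ det≡1)
      (≡-mod-trans (det s) (det t) 0ℤ (det-cong {s} {t} s≃t)
        (subst (λ z → det t ≡ z [mod N ]) det≡0 (≡-mod-refl (det t)))))

module Isomorphism (N M : ℕ) (2<N : 2 < N) where

  open Symbols N M
  private
    module Γ = AbelianGroup (𝕄₂Γ N M)
    module 𝓜 = AbelianGroup (𝓜⁻ N M)
    module ΓProps = GroupProperties Γ.group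

  Γ-gen-≡ : ∀ {s t} (p : 𝒮₊ s) (q : 𝒮₊ t) → s ≡ t → gen (s , p) Γ.≈ gen (t , q)
  Γ-gen-≡ {s} p q refl = rel (ident p q (≃-refl s))

  Γ-rotate : ∀ {s} (p : 𝒮₊ s) (q : 𝒮₊ (rotate s)) → gen (rotate s , q) Γ.≈ ⊖ gen (s , p)
  Γ-rotate p q = ΓProps.inverseʳ-unique _ _ (rel (rel1 p q))

  Γ-relM : ∀ {s} (p : 𝒮₊ s) →
            gen (s , p) Γ.≈ gen (shearˡ s , InS-shearˡ 1ℤ p) ⊕ gen (shearʳ s , InS-shearʳ 1ℤ p)
  Γ-relM {s@(β₁ , β₂)} p = begin
      X          ≈⟨ ΓProps.⁻¹-involutive X ⟨
      ⊖ ⊖ X      ≈⟨ ⊖-cong (Γ-rotate p (InS-rotate 1ℤ p)) ⟨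
      ⊖ C        ≈⟨ ΓProps.inverseˡ-unique (A ⊕ B) C relation2 ⟨
      A ⊕ B      ∎
    where
      open SetoidReasoning Γ.setoid
      X A B C : Term (GenΓ N M)
      X = gen (s , p)
      A = gen (shearˡ s , InS-shearˡ 1ℤ p)
      B = gen (shearʳ s , InS-shearʳ 1ℤ p)
      C = gen (rotate s , InS-rotate 1ℤ p)
      B≡ : shearʳ s ≡ ((β₁ -ᶜ β₂) +ᶜ β₂ , -ᶜ (β₁ -ᶜ β₂))
      B≡ = ≡-sym (cong₂ _,_ (x-y+y≡x β₁ β₂) (-[x-y]≡y-x β₁ β₂))
      C≡ : rotate s ≡ (β₂ , -ᶜ (β₁ -ᶜ β₂) -ᶜ β₂)
      C≡ = ≡-sym (cong (β₂ ,_) (-[x-y]-y≡-x β₁ β₂))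
      B′ = subst 𝒮₊ B≡ (InS-shearʳ 1ℤ p)
      C′ = subst 𝒮₊ C≡ (InS-rotate 1ℤ p)
      relation2 : A ⊕ B ⊕ C Γ.≈ 𝟎
      relation2 = trans (⊕-cong (⊕-cong refl (Γ-gen-≡ _ B′ B≡)) (Γ-gen-≡ _ C′ C≡))
                        (rel (rel2 (InS-shearˡ 1ℤ p) B′ C′))

  𝓜-gen-≡ : ∀ {s t} (x : 𝒮± s) (y : 𝒮± t) → s ≡ t → gen (s , x) 𝓜.≈ gen (t , y)
  𝓜-gen-≡ {s} x y refl = rel (ident x y (≃-refl s))

  𝓜-rotate : ∀ {s} (p : 𝒮₊ s) (q : 𝒮₊ (rotate s)) → gen (rotate s , inj₁ q) 𝓜.≈ ⊖ gen (s , inj₁ p)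
  𝓜-rotate {β₁ , β₂} p q = begin
    gen ((β₂ , -ᶜ β₁) , inj₁ q)        ≈⟨ rel (relO (inj₁ q) (inj₂ q′)) ⟩
    gen ((-ᶜ β₁ , β₂) , inj₂ q′)       ≈⟨ rel (relA (inj₂ q′) (inj₁ q″)) ⟩
    ⊖ gen ((-ᶜ -ᶜ β₁ , β₂) , inj₁ q″)  ≈⟨ ⊖-cong (𝓜-gen-≡ (inj₁ q″) (inj₁ p) (cong (_, β₂) (-ᶜ-involutive β₁))) ⟩
    ⊖ gen ((β₁ , β₂) , inj₁ p)         ∎
    where
      open SetoidReasoning 𝓜.setoid
      q′ = InS-swap 1ℤ q
      q″ = InS-negateˡ (- 1ℤ) q′

  toManin : GenM N M → Term (GenΓ N M)
  toManin (s , inj₁ p) = gen (s , p)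
  toManin (s , inj₂ p) = gen (swap s , InS-swap (- 1ℤ) p)

  fromManin : GenΓ N M → Term (GenM N M)
  fromManin (s , p) = gen (s , inj₁ p)

  toManin-𝒮₊ : ∀ {s t} (p : 𝒮₊ s) → _≃_ N M s t → (x : 𝒮± t) →
               gen (s , p) Γ.≈ toManin (t , x)
  toManin-𝒮₊ p s≃t (inj₁ q) = rel (ident p q s≃t)
  toManin-𝒮₊ {s} {t} p s≃t (inj₂ q) = ⊥-elim (𝒮₊-𝒮₋-disjoint 2<N p q (det-cong {s} {t} s≃t))

  toManin-𝒮₋ : ∀ {s t} (p : 𝒮₊ (swap s)) → _≃_ N M s t → (x : 𝒮± t) →
               gen (swap s , p) Γ.≈ toManin (t , x)
  toManin-𝒮₋ {s} {t} p s≃t (inj₁ q) =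
    ⊥-elim (𝒮₊-𝒮₋-disjoint 2<N q (InS-swap 1ℤ p) (≡-mod-sym (det s) (det t) (det-cong {s} {t} s≃t)))
  toManin-𝒮₋ p s≃t (inj₂ q) = rel (ident p (InS-swap (- 1ℤ) q) (swap s≃t))

  toManin-resp : ∀ {x y} → RelM N M x y → extend toManin x Γ.≈ extend toManin y
  toManin-resp (ident (inj₁ p) y s≃t) = toManin-𝒮₊ p s≃t y
  toManin-resp (ident (inj₂ p) y s≃t) = toManin-𝒮₋ (InS-swap (- 1ℤ) p) s≃t y
  toManin-resp (relO {β₁} {β₂} (inj₁ p) y) = toManin-𝒮₋ p (≃-refl (β₂ , β₁)) y
  toManin-resp (relO {β₁} {β₂} (inj₂ p) y) = toManin-𝒮₊ (InS-swap (- 1ℤ) p) (≃-refl (β₂ , β₁)) y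
  toManin-resp (relA {β₁} {β₂} (inj₁ p) y) =
    trans (ΓProps.inverseˡ-unique _ _ (rel (rel1 p p′)))
          (⊖-cong (toManin-𝒮₋ p′ (≃-refl (-ᶜ β₁ , β₂)) y))
    where p′ = InS-rotate 1ℤ p
  toManin-resp (relA {β₁} {β₂} (inj₂ p) y) =
    trans (Γ-gen-≡ (InS-swap (- 1ℤ) p) (InS-rotate 1ℤ p′) (cong (β₂ ,_) (≡-sym (-ᶜ-involutive β₁))))
          (trans (Γ-rotate p′ (InS-rotate 1ℤ p′)) (⊖-cong (toManin-𝒮₊ p′ (≃-refl (-ᶜ β₁ , β₂)) y)))
    where p′ = InS-negateˡ (- 1ℤ) p
  toManin-resp (relM {β₁} {β₂} (inj₁ p) y z) =
    trans (Γ-relM p) (⊕-cong (toManin-𝒮₊ (InS-shearˡ 1ℤ p) (≃-refl (β₁ -ᶜ β₂ , β₂)) y)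
                              (toManin-𝒮₊ (InS-shearʳ 1ℤ p) (≃-refl (β₁ , β₂ -ᶜ β₁)) z))
  toManin-resp (relM {β₁} {β₂} (inj₂ p) y z) =
    trans (Γ-relM p′)
          (trans comm (⊕-cong (toManin-𝒮₋ (InS-shearʳ 1ℤ p′) (≃-refl (β₁ -ᶜ β₂ , β₂)) y)
                              (toManin-𝒮₋ (InS-shearˡ 1ℤ p′) (≃-refl (β₁ , β₂ -ᶜ β₁)) z)))
    where p′ = InS-swap (- 1ℤ) p

  fromManin-resp : ∀ {x y} → RelΓ N M x y → extend fromManin x 𝓜.≈ extend fromManin y
  fromManin-resp (ident p q s≃t) = rel (ident (inj₁ p) (inj₁ q) s≃t)
  fromManin-resp (rel1 p q) = trans (⊕-cong refl (𝓜-rotate p q)) (𝓜.inverseʳ _)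
  fromManin-resp (rel2 {a} {b} {c} {d} p q r) = trans (⊕-cong (sym U≈X⊕Y) Z≈⊖U) (𝓜.inverseʳ U)
    where
      β₁ β₂ : Char
      β₁ = (a , c)
      β₂ = (b , d)
      u = (β₁ +ᶜ β₂ , β₂)
      pᵤ : 𝒮₊ u
      pᵤ = subst 𝒮₊ (cong (_, β₂) (-[-x-y]≡x+y β₁ β₂)) (InS-negateˡ (- 1ℤ) (InS-swap 1ℤ r))
      U = gen (u , inj₁ pᵤ)
      U≈X⊕Y : U 𝓜.≈ gen ((β₁ , β₂) , inj₁ p) ⊕ gen ((β₁ +ᶜ β₂ , -ᶜ β₁) , inj₁ q)
      U≈X⊕Y = trans (rel (relM (inj₁ pᵤ) (inj₁ (InS-shearˡ 1ℤ pᵤ)) (inj₁ (InS-shearʳ 1ℤ pᵤ))))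
                    (⊕-cong (𝓜-gen-≡ _ (inj₁ p) (cong (_, β₂) (x+y-y≡x β₁ β₂)))
                            (𝓜-gen-≡ _ (inj₁ q) (cong (β₁ +ᶜ β₂ ,_) (y-[x+y]≡-x β₁ β₂))))
      Z≈⊖U : gen ((β₂ , -ᶜ β₁ -ᶜ β₂) , inj₁ r) 𝓜.≈ ⊖ U
      Z≈⊖U = trans (𝓜-gen-≡ (inj₁ r) (inj₁ pᵤ′) (cong (β₂ ,_) (≡-sym (-ᶜ-distrib-+ᶜ β₁ β₂))))
                   (𝓜-rotate pᵤ pᵤ′)
        where pᵤ′ = InS-rotate 1ℤ pᵤ
  fromManin-resp (rel3a {b = b} {d = d} p (β₁∼β₂ , _)) =
    ⊥-elim (𝒮₊-nondegenerate (<⇒≤ 2<N) {t = ((b , d) , (b , d))} p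
              (β₁∼β₂ , ∼-refl (b , d)) (det-diagonal (b , d)))
  fromManin-resp (rel3b {a} {c = c} p (_ , β₂∼-β₁)) =
    ⊥-elim (𝒮₊-nondegenerate (<⇒≤ 2<N) {t = ((a , c) , -ᶜ (a , c))} p
              (∼-refl (a , c) , β₂∼-β₁) (det-antidiagonal (a , c)))

  fromManin-toManin : ∀ g → extend fromManin (toManin g) 𝓜.≈ gen g
  fromManin-toManin (s , inj₁ p) = refl
  fromManin-toManin (s , inj₂ p) = rel (relO (inj₁ (InS-swap (- 1ℤ) p)) (inj₂ p))

  toManin-fromManin : ∀ h → extend toManin (fromManin h) Γ.≈ gen h
  toManin-fromManin h = refl

proposition3p5 : (N M : ℕ) → 2 < N → 1 ≤ M → 𝓜⁻ N M ≅ 𝕄₂Γ N M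
proposition3p5 N M 2<N _ =
  Presented-≅ toManin fromManin toManin-resp fromManin-resp fromManin-toManin toManin-fromManin
  where open Isomorphism N M 2<N
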